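{- Let $q$ be an odd positive integer and $m\in\mathbb{N}$, and let $N=q\,2^m$. Suppose the scaled $q$-point DCT-II $\tilde{C}^{II}_q$ is computed with $\tilde{\mu}(q)$ multiplications, $\tilde{\alpha}(q)$ additions/subtractions and $\tilde{\sigma}(q)$ shifts, and that the non-scaled $q$-point transform is computed with $\mu(q)$ multiplications, $\alpha(q)$ additions/subtractions and $\sigma(q)$ shifts. Then computing the scaled DCT-II $\tilde{C}^{II}_N$ by the recursive factorization described in the context uses $$\tilde{\mu}(N)=\tilde{\mu}(q)+(2^m-1)\mu(q)+\left(\tfrac{m}{2}-1+2^{ -m}\right)N$$ multiplications, $$\tilde{\alpha}(N)=\tilde{\alpha}(q)+(2^m-1)\alpha(q)+\tfrac{3m}{2}N-2^m+1$$ additions/subtractions, and $$\tilde{\sigma}(N)=\tilde{\sigma}(q)+(2^m-1)\sigma(q)+2^m-1$$ shifts.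
   Context: Matrices (normalization factors omitted): the $N$-point DCT-II is $[C^{II}_N]_{n,k}=\cos\left(\frac{\pi(2n+1)k}{2N}\right)$ and DCT-III is $C^{III}_N=(C^{II}_N)^T$, for $n,k=0,\dots,N-1$. For even $M$, $I_{M/2}$ and $J_{M/2}$ are the $M/2\times M/2$ identity and order-reversal matrices, $B_M=\begin{pmatrix} I_{M/2} & J_{M/2}\\ J_{M/2} & -I_{M/2}\end{pmatrix}$, $R_{K}$ is the $K\times K$ lower-triangular matrix with first column $(\tfrac12,-\tfrac12,\tfrac12,\dots)^T$ and, for column $j\ge 1$, entries $(-1)^{i-j}$ for $i\ge j$ and $0$ above the diagonal (so $R_K x$ is computed by recursive subtractions), and $D_K=\mathrm{diag}\left(2\cos\frac{(2i+1)\pi}{4K}\right)_{i=0}^{K-1}$. A factorization is called scaled if $C^{II}_N=\Pi_N\Delta_N\tilde{C}^{II}_N$ with $\Pi_N$ a reordering (permutation) matrix and $\Delta_N$ a diagonal matrix of scale factors; only $\tilde{C}^{II}_N$ is computed. The scaled transform is computed recursively by $\tilde{C}^{II}_M=\begin{pmatrix}\tilde{C}^{II}_{M/2} & 0\\ 0 & C^{III}_{M/2}R^T_{M/2}J_{M/2}\end{pmatrix}B_M$ for $M=q2^k$, $k=1,\dots,m$, down to the base block $\tilde{C}^{II}_q$ (with $\Pi_M=P_M\,\mathrm{diag}(\Pi_{M/2},I_{M/2})$, $\Delta_M=\mathrm{diag}(\Delta_{M/2},D_{M/2})$, $P_M$ the permutation taking $x$ to $(x_0,x_2,\dots,x_{M-2},x_1,x_3,\dots,x_{M-1})$).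 The butterfly $B_M$ costs $M$ additions/subtractions; applying $R^T_{M/2}J_{M/2}$ costs $M/2-1$ additions/subtractions and one shift (the factor $\tfrac12$). Each non-scaled block $C^{III}_{q2^k}$ is computed (as a transposed flowgraph) by C.\,W.~Kok's recursive algorithm $C^{II}_K=P_K\begin{pmatrix}C^{II}_{K/2}&0\\0&R_{K/2}C^{II}_{K/2}D_{K/2}J_{K/2}\end{pmatrix}B_K$ down to length $q$, whose operation counts for length $K=q2^k$ are $\mu(K)=2^k\mu(q)+\tfrac{k}{2}K$, $\alpha(K)=2^k\alpha(q)+\tfrac{3k}{2}K-2^k+1$, $\sigma(K)=2^k\sigma(q)+2^k-1$. Operation classes: "multiplications" are multiplications by non-trivial constants, "additions" include subtractions, and "shifts" are multiplications by dyadic factors such as $\tfrac12$. -}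

module Defs where

open import Data.Nat using (ℕ; zero; suc; _+_; _*_; _∸_; _^_)
open import Data.Nat.DivMod using (_/_)

-- Operation counts of an algorithm: multiplications (by non-trivial
-- constants), additions/subtractions, and shifts (dyadic factors).
record Cost : Set where
  constructor cost
  field
    mul : ℕ
    add : ℕ
    shf : ℕ
open Cost public

len : ℕ → ℕ → ℕ
len q k = q * 2 ^ k

-- Kok's operation counts (as given in the context) for the non-scaled
-- length-(q 2^k) transform, given the counts c of the length-q transform:
--   μ(K) = 2^k μ(q) + (k/2) K
--   α(K) = 2^k α(q) + (3k/2) K - 2^k + 1
--   σ(K) = 2^k σ(q) + 2^k - 1
-- (k K / 2 is always an integer here: k = 0 or K even.)
kokCost : ℕ → Cost → ℕ → Cost
kokCost q c k =
  cost (2 ^ k * mul c + (k * len q k) / 2)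
       ((2 ^ k * add c + (3 * k * len q k) / 2 + 1) ∸ 2 ^ k)
       (2 ^ k * shf c + 2 ^ k ∸ 1)

-- Operation counts of the recursive scaled algorithm for length q 2^k,
-- given counts b of the scaled length-q base block and counts c of the
-- non-scaled length-q transform.  Step M/2 = q 2^k  ↦  M = q 2^(k+1):
--   tilde C_M = diag(tilde C_{M/2}, C^III_{M/2} R^T_{M/2} J_{M/2}) B_M
-- costs: tilde C_{M/2}; C^III_{M/2} (computed by Kok's algorithm,
-- transposed flowgraph, same counts); R^T J: M/2 - 1 additions and
-- one shift; B_M: M additions.  The scale factors Δ are not computed.
scaledCost : ℕ → Cost → Cost → ℕ → Cost
scaledCost q b c zero = b
scaledCost q b c (suc k) =
  cost (mul s + mul t)
       (add s + add t + (len q (suc k) + (len q k ∸ 1)))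
       (shf s + shf t + 1)
  where
    s = scaledCost q b c k
    t = kokCost q c k

module Submission where

-- The recursion  tilde C_{2K} = diag(tilde C_K, C^III_K R^T_K J_K) B_{2K}
-- makes each count of the scaled algorithm a first-order recurrence in m:
-- the level-m increment is the cost of Kok's non-scaled block of length
-- K = q 2^m, plus (for additions and shifts) the cost of R^T J and of the
-- butterfly.

open import Defs
open import Data.Nat using (ℕ; _*_; _∸_; _^_; _%_; _>_)
open import Data.Integer using (ℤ; +_; _+_; _-_) renaming (_*_ to _*ℤ_)
open import Data.Product using (_×_)
open import Relation.Binary.PropositionalEquality using (_≡_)

open import Data.Nat as ℕ using (zero; suc; _≤_)
import Data.Nat.Properties as ℕₚ
open import Data.Nat.DivMod using (_/_; m*[n/m]≡n)
open import Data.Nat.Divisibility using (_∣_; _∣0; m∣m*n; ∣n⇒∣m*n)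
open import Data.Integer.Properties using (pos-+; pos-*; m-n≡m⊖n; ⊖-≥; +-assoc; *-distribˡ-+)
open import Data.Integer.Tactic.RingSolver using (solve-∀)
open import Data.Product using (_,_)
open import Relation.Binary.PropositionalEquality
  using (sym; trans; cong; cong₂; subst; module ≡-Reasoning)
open ≡-Reasoning

recurrence-unique : {A : Set} (step : ℕ → A → A) (f g : ℕ → A) → f 0 ≡ g 0 →
  (∀ m → f (suc m) ≡ step m (f m)) → (∀ m → g (suc m) ≡ step m (g m)) →
  ∀ m → f m ≡ g m
recurrence-unique step f g f0≡g0 f-step g-step zero = f0≡g0
recurrence-unique step f g f0≡g0 f-step g-step (suc m) = begin
  f (suc m)    ≡⟨ f-step m ⟩
  step m (f m) ≡⟨ cong (step m) (recurrence-unique step f g f0≡g0 f-step g-step m) ⟩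
  step m (g m) ≡⟨ g-step m ⟨
  g (suc m)    ∎

pos-∸ : ∀ {m n} → n ≤ m → + (m ∸ n) ≡ + m - + n
pos-∸ {m} {n} n≤m = sym (trans (m-n≡m⊖n m n) (⊖-≥ n≤m))

pos-*-* : ∀ a b c → + (a * (b * c)) ≡ + a *ℤ (+ b *ℤ + c)
pos-*-* a b c = trans (pos-* a (b * c)) (cong (+ a *ℤ_) (pos-* b c))

pow2 : ℕ → ℤ
pow2 k = + (2 ^ k)

pow2-suc : ∀ k → pow2 (suc k) ≡ + 2 *ℤ pow2 k
pow2-suc k = pos-* 2 (2 ^ k)

len-suc : ∀ q k → + len q (suc k) ≡ + 2 *ℤ + len q k
len-suc q k = trans (cong +_ swap) (pos-* 2 (len q k))
  where
  swap : q * (2 * 2 ^ k) ≡ 2 * (q * 2 ^ k)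
  swap = trans (sym (ℕₚ.*-assoc q 2 (2 ^ k)))
               (trans (cong (_* 2 ^ k) (ℕₚ.*-comm q 2)) (ℕₚ.*-assoc 2 q (2 ^ k)))

len-pos : ∀ q k → q > 0 → 1 ≤ len q k
len-pos q k q>0 = ℕₚ.*-mono-≤ q>0 (ℕₚ.m^n>0 2 k)

-- k K is even: it is 0 for k = 0, and 2 ∣ K otherwise.  Hence the halves
-- (k/2) K and (3k/2) K in Kok's counts are exact.
even-k*len : ∀ q k → 2 ∣ k * len q k
even-k*len q zero = 2 ∣0
even-k*len q (suc k) = ∣n⇒∣m*n (suc k) (∣n⇒∣m*n q (m∣m*n (2 ^ k)))

double-plus-half : ∀ a n → 2 ∣ n → 2 * (a ℕ.+ n / 2) ≡ 2 * a ℕ.+ n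
double-plus-half a n 2∣n =
  trans (ℕₚ.*-distribˡ-+ 2 a (n / 2)) (cong (2 * a ℕ.+_) (m*[n/m]≡n 2∣n))

pow2≤k*len : ∀ q j → q > 0 → 2 ^ suc j ≤ suc j * len q (suc j)
pow2≤k*len (suc q) j _ =
  ℕₚ.≤-trans (ℕₚ.m≤n*m (2 ^ suc j) (suc q)) (ℕₚ.m≤n*m (len (suc q) (suc j)) (suc j))

-- The subtraction of 2^k in Kok's addition count does not truncate, in the
-- doubled form  2·2^k ≤ 3 k K + 2.
kok-add-bound : ∀ q k → q > 0 → 2 * 2 ^ k ≤ 3 * k * len q k ℕ.+ 2
kok-add-bound q zero _ = ℕₚ.≤-refl
kok-add-bound q (suc j) q>0 =
  ℕₚ.≤-trans (ℕₚ.*-monoˡ-≤ (2 ^ suc j) (ℕₚ.n≤1+n 2))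
    (ℕₚ.≤-trans (ℕₚ.*-monoʳ-≤ 3 (pow2≤k*len q j q>0))
      (ℕₚ.≤-trans (ℕₚ.≤-reflexive (sym (ℕₚ.*-assoc 3 (suc j) (len q (suc j)))))
        (ℕₚ.m≤m+n (3 * suc j * len q (suc j)) 2)))

kok-mul : ∀ q c k →
  + 2 *ℤ + mul (kokCost q c k) ≡ + 2 *ℤ (pow2 k *ℤ + mul c) + + k *ℤ + len q k
kok-mul q c k = begin
  + 2 *ℤ + mul (kokCost q c k)             ≡⟨ pos-* 2 (mul (kokCost q c k)) ⟨
  + (2 * (2 ^ k * mul c ℕ.+ k * len q k / 2)) ≡⟨ cong +_ (double-plus-half (2 ^ k * mul c) (k * len q k) (even-k*len q k)) ⟩
  + (2 * (2 ^ k * mul c) ℕ.+ k * len q k)  ≡⟨ pos-+ (2 * (2 ^ k * mul c)) (k * len q k) ⟩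
  + (2 * (2 ^ k * mul c)) + + (k * len q k)
    ≡⟨ cong₂ _+_ (pos-*-* 2 (2 ^ k) (mul c)) (pos-* k (len q k)) ⟩
  + 2 *ℤ (pow2 k *ℤ + mul c) + + k *ℤ + len q k ∎

kok-add : ∀ q c k → q > 0 →
  + 2 *ℤ + add (kokCost q c k)
    ≡ + 2 *ℤ (pow2 k *ℤ + add c) + + 3 *ℤ + k *ℤ + len q k + + 2 - + 2 *ℤ pow2 k
kok-add q c k q>0 = begin
  + 2 *ℤ + (A ∸ 2 ^ k)             ≡⟨ pos-* 2 (A ∸ 2 ^ k) ⟨
  + (2 * (A ∸ 2 ^ k))             ≡⟨ cong +_ (ℕₚ.*-distribˡ-∸ 2 A (2 ^ k)) ⟩
  + (2 * A ∸ 2 * 2 ^ k)           ≡⟨ pos-∸ no-truncation ⟩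
  + (2 * A) - + (2 * 2 ^ k)       ≡⟨ cong₂ _-_ (cong +_ doubled) (pos-* 2 (2 ^ k)) ⟩
  + (X ℕ.+ Y ℕ.+ 2) - + 2 *ℤ pow2 k
    ≡⟨ cong (_- + 2 *ℤ pow2 k) (trans (pos-+ (X ℕ.+ Y) 2) (cong (_+ + 2) (pos-+ X Y))) ⟩
  + X + + Y + + 2 - + 2 *ℤ pow2 k
    ≡⟨ cong (λ z → z + + 2 - + 2 *ℤ pow2 k)
            (cong₂ _+_ (pos-*-* 2 (2 ^ k) (add c))
                       (trans (pos-* (3 * k) (len q k)) (cong (_*ℤ + len q k) (pos-* 3 k)))) ⟩
  + 2 *ℤ (pow2 k *ℤ + add c) + + 3 *ℤ + k *ℤ + len q k + + 2 - + 2 *ℤ pow2 k ∎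
  where
  A = 2 ^ k * add c ℕ.+ 3 * k * len q k / 2 ℕ.+ 1
  X = 2 * (2 ^ k * add c)
  Y = 3 * k * len q k
  even-Y : 2 ∣ Y
  even-Y = subst (2 ∣_) (sym (ℕₚ.*-assoc 3 k (len q k))) (∣n⇒∣m*n 3 (even-k*len q k))
  doubled : 2 * A ≡ X ℕ.+ Y ℕ.+ 2
  doubled = trans (ℕₚ.*-distribˡ-+ 2 (2 ^ k * add c ℕ.+ Y / 2) 1)
                  (cong (ℕ._+ 2) (double-plus-half (2 ^ k * add c) Y even-Y))
  no-truncation : 2 * 2 ^ k ≤ 2 * A
  no-truncation = ℕₚ.≤-trans (kok-add-bound q k q>0)
    (ℕₚ.≤-trans (ℕₚ.+-monoˡ-≤ 2 (ℕₚ.m≤n+m Y X)) (ℕₚ.≤-reflexive (sym doubled)))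

kok-shf : ∀ q c k → + shf (kokCost q c k) ≡ pow2 k *ℤ + shf c + pow2 k - + 1
kok-shf q c k = begin
  + (2 ^ k * shf c ℕ.+ 2 ^ k ∸ 1)
    ≡⟨ pos-∸ (ℕₚ.≤-trans (ℕₚ.m^n>0 2 k) (ℕₚ.m≤n+m (2 ^ k) (2 ^ k * shf c))) ⟩
  + (2 ^ k * shf c ℕ.+ 2 ^ k) - + 1
    ≡⟨ cong (_- + 1) (trans (pos-+ (2 ^ k * shf c) (2 ^ k)) (cong (_+ pow2 k) (pos-* (2 ^ k) (shf c)))) ⟩
  pow2 k *ℤ + shf c + pow2 k - + 1 ∎

-- Additions for R^T_K J_K (K - 1) and for the butterfly B_{2K} (2K).
rj-butterfly-add : ∀ q k → q > 0 →
  + (len q (suc k) ℕ.+ (len q k ∸ 1)) ≡ + 2 *ℤ + len q k + (+ len q k - + 1)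
rj-butterfly-add q k q>0 =
  trans (pos-+ (len q (suc k)) (len q k ∸ 1)) (cong₂ _+_ (len-suc q k) (pos-∸ (len-pos q k q>0)))

pred-pow2 : ∀ m → + (2 ^ m ∸ 1) ≡ pow2 m - + 1
pred-pow2 m = pos-∸ (ℕₚ.m^n>0 2 m)

pred-pow2-suc : ∀ m → + (2 ^ suc m ∸ 1) ≡ + 2 *ℤ pow2 m - + 1
pred-pow2-suc m = trans (pred-pow2 (suc m)) (cong (_- + 1) (pow2-suc m))

module ScaledCounts (q : ℕ) (q>0 : q > 0) (b c : Cost) where

  scaledMul scaledAdd scaledShf : ℕ → ℤ
  scaledMul m = + 2 *ℤ + mul (scaledCost q b c m)
  scaledAdd m = + 2 *ℤ + add (scaledCost q b c m)
  scaledShf m = + shf (scaledCost q b c m)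

  -- Cost of going from level m to m + 1: Kok's block C^III of length q 2^m,
  -- plus R^T J and the butterfly for additions, plus the one shift of R^T.
  mulIncrement addIncrement shfIncrement : ℕ → ℤ
  mulIncrement m = + 2 *ℤ (pow2 m *ℤ + mul c) + + m *ℤ + len q m
  addIncrement m =
    (+ 2 *ℤ (pow2 m *ℤ + add c) + + 3 *ℤ + m *ℤ + len q m + + 2 - + 2 *ℤ pow2 m)
    + + 2 *ℤ (+ 2 *ℤ + len q m + (+ len q m - + 1))
  shfIncrement m = (pow2 m *ℤ + shf c + pow2 m - + 1) + + 1

  scaledMul-step : ∀ m → scaledMul (suc m) ≡ scaledMul m + mulIncrement m
  scaledMul-step m = begin
    + 2 *ℤ + (ms ℕ.+ mt)          ≡⟨ cong (+ 2 *ℤ_) (pos-+ ms mt) ⟩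
    + 2 *ℤ (+ ms + + mt)          ≡⟨ *-distribˡ-+ (+ 2) (+ ms) (+ mt) ⟩
    + 2 *ℤ + ms + + 2 *ℤ + mt     ≡⟨ cong (_+_ (scaledMul m)) (kok-mul q c m) ⟩
    scaledMul m + mulIncrement m ∎
    where
    ms = mul (scaledCost q b c m)
    mt = mul (kokCost q c m)

  scaledAdd-step : ∀ m → scaledAdd (suc m) ≡ scaledAdd m + addIncrement m
  scaledAdd-step m = begin
    + 2 *ℤ + (as ℕ.+ at ℕ.+ e)
      ≡⟨ cong (+ 2 *ℤ_) (trans (pos-+ (as ℕ.+ at) e) (cong (_+ + e) (pos-+ as at))) ⟩
    + 2 *ℤ (+ as + + at + + e)
      ≡⟨ trans (*-distribˡ-+ (+ 2) (+ as + + at) (+ e))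
               (cong (_+ + 2 *ℤ + e) (*-distribˡ-+ (+ 2) (+ as) (+ at))) ⟩
    + 2 *ℤ + as + + 2 *ℤ + at + + 2 *ℤ + e
      ≡⟨ cong₂ (λ x y → + 2 *ℤ + as + x + + 2 *ℤ y) (kok-add q c m q>0) (rj-butterfly-add q m q>0) ⟩
    + 2 *ℤ + as + (+ 2 *ℤ (pow2 m *ℤ + add c) + + 3 *ℤ + m *ℤ + len q m + + 2 - + 2 *ℤ pow2 m)
      + + 2 *ℤ (+ 2 *ℤ + len q m + (+ len q m - + 1))
      ≡⟨ +-assoc (+ 2 *ℤ + as) _ _ ⟩
    scaledAdd m + addIncrement m ∎
    where
    as = add (scaledCost q b c m)
    at = add (kokCost q c m)
    e = len q (suc m) ℕ.+ (len q m ∸ 1)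

  scaledShf-step : ∀ m → scaledShf (suc m) ≡ scaledShf m + shfIncrement m
  scaledShf-step m = begin
    + (ss ℕ.+ st ℕ.+ 1)      ≡⟨ trans (pos-+ (ss ℕ.+ st) 1) (cong (_+ + 1) (pos-+ ss st)) ⟩
    + ss + + st + + 1        ≡⟨ cong (λ x → + ss + x + + 1) (kok-shf q c m) ⟩
    + ss + (pow2 m *ℤ + shf c + pow2 m - + 1) + + 1
                             ≡⟨ +-assoc (+ ss) (pow2 m *ℤ + shf c + pow2 m - + 1) (+ 1) ⟩
    scaledShf m + shfIncrement m ∎
    where
    ss = shf (scaledCost q b c m)
    st = shf (kokCost q c m)

  mulForm : (k D L : ℤ) → ℤ
  mulForm k D L = + 2 *ℤ + mul b + + 2 *ℤ (D *ℤ + mul c) + (k - + 2) *ℤ L + + 2 *ℤ + q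

  addForm : (k D P L : ℤ) → ℤ
  addForm k D P L = + 2 *ℤ + add b + + 2 *ℤ (D *ℤ + add c) + + 3 *ℤ (k *ℤ L) - + 2 *ℤ P + + 2

  shfForm : (D P : ℤ) → ℤ
  shfForm D P = + shf b + D *ℤ + shf c + P - + 1

  mulClosed addClosed shfClosed : ℕ → ℤ
  mulClosed m = mulForm (+ m) (+ (2 ^ m ∸ 1)) (+ len q m)
  addClosed m = addForm (+ m) (+ (2 ^ m ∸ 1)) (pow2 m) (+ len q m)
  shfClosed m = shfForm (+ (2 ^ m ∸ 1)) (pow2 m)

  mul-base : scaledMul 0 ≡ mulClosed 0
  mul-base = trans (identity (+ mul b) (+ mul c) (+ q)) (cong (mulForm (+ 0) (+ 0)) (sym (pos-* q 1)))
    where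
    identity : ∀ (mb μ q : ℤ) →
      + 2 *ℤ mb ≡ + 2 *ℤ mb + + 2 *ℤ (+ 0 *ℤ μ) + (+ 0 - + 2) *ℤ (q *ℤ + 1) + + 2 *ℤ q
    identity = solve-∀

  add-base : scaledAdd 0 ≡ addClosed 0
  add-base = identity (+ add b) (+ add c) (+ len q 0)
    where
    identity : ∀ (ab α L : ℤ) →
      + 2 *ℤ ab ≡ + 2 *ℤ ab + + 2 *ℤ (+ 0 *ℤ α) + + 3 *ℤ (+ 0 *ℤ L) - + 2 *ℤ + 1 + + 2
    identity = solve-∀

  shf-base : scaledShf 0 ≡ shfClosed 0
  shf-base = identity (+ shf b) (+ shf c)
    where
    identity : ∀ (sb σ : ℤ) → sb ≡ sb + + 0 *ℤ σ + + 1 - + 1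
    identity = solve-∀

  mulClosed-step : ∀ m → mulClosed (suc m) ≡ mulClosed m + mulIncrement m
  mulClosed-step m = begin
    mulForm (+ suc m) (+ (2 ^ suc m ∸ 1)) (+ len q (suc m))
      ≡⟨ cong₂ (mulForm (+ suc m)) (pred-pow2-suc m) (len-suc q m) ⟩
    mulForm (+ suc m) (+ 2 *ℤ P - + 1) (+ 2 *ℤ L)
      ≡⟨ identity (+ mul b) (+ mul c) (+ q) (+ m) P L ⟩
    mulForm (+ m) (P - + 1) L + mulIncrement m
      ≡⟨ cong (λ D → mulForm (+ m) D L + mulIncrement m) (pred-pow2 m) ⟨
    mulClosed m + mulIncrement m ∎
    where
    P = pow2 m
    L = + len q m
    identity : ∀ (mb μ q k P L : ℤ) →
      + 2 *ℤ mb + + 2 *ℤ ((+ 2 *ℤ P - + 1) *ℤ μ) + ((+ 1 + k) - + 2) *ℤ (+ 2 *ℤ L) + + 2 *ℤ q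
        ≡ + 2 *ℤ mb + + 2 *ℤ ((P - + 1) *ℤ μ) + (k - + 2) *ℤ L + + 2 *ℤ q
          + (+ 2 *ℤ (P *ℤ μ) + k *ℤ L)
    identity = solve-∀

  addClosed-step : ∀ m → addClosed (suc m) ≡ addClosed m + addIncrement m
  addClosed-step m = begin
    addForm (+ suc m) (+ (2 ^ suc m ∸ 1)) (pow2 (suc m)) (+ len q (suc m))
      ≡⟨ cong₂ (λ D L′ → addForm (+ suc m) D (pow2 (suc m)) L′) (pred-pow2-suc m) (len-suc q m) ⟩
    addForm (+ suc m) (+ 2 *ℤ P - + 1) (pow2 (suc m)) (+ 2 *ℤ L)
      ≡⟨ cong (λ P′ → addForm (+ suc m) (+ 2 *ℤ P - + 1) P′ (+ 2 *ℤ L)) (pow2-suc m) ⟩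
    addForm (+ suc m) (+ 2 *ℤ P - + 1) (+ 2 *ℤ P) (+ 2 *ℤ L)
      ≡⟨ identity (+ add b) (+ add c) (+ m) P L ⟩
    addForm (+ m) (P - + 1) P L + addIncrement m
      ≡⟨ cong (λ D → addForm (+ m) D P L + addIncrement m) (pred-pow2 m) ⟨
    addClosed m + addIncrement m ∎
    where
    P = pow2 m
    L = + len q m
    identity : ∀ (ab α k P L : ℤ) →
      + 2 *ℤ ab + + 2 *ℤ ((+ 2 *ℤ P - + 1) *ℤ α) + + 3 *ℤ ((+ 1 + k) *ℤ (+ 2 *ℤ L))
        - + 2 *ℤ (+ 2 *ℤ P) + + 2
        ≡ + 2 *ℤ ab + + 2 *ℤ ((P - + 1) *ℤ α) + + 3 *ℤ (k *ℤ L) - + 2 *ℤ P + + 2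
          + ((+ 2 *ℤ (P *ℤ α) + + 3 *ℤ k *ℤ L + + 2 - + 2 *ℤ P)
             + + 2 *ℤ (+ 2 *ℤ L + (L - + 1)))
    identity = solve-∀

  shfClosed-step : ∀ m → shfClosed (suc m) ≡ shfClosed m + shfIncrement m
  shfClosed-step m = begin
    shfForm (+ (2 ^ suc m ∸ 1)) (pow2 (suc m))
      ≡⟨ cong₂ shfForm (pred-pow2-suc m) (pow2-suc m) ⟩
    shfForm (+ 2 *ℤ P - + 1) (+ 2 *ℤ P)
      ≡⟨ identity (+ shf b) (+ shf c) P ⟩
    shfForm (P - + 1) P + shfIncrement m
      ≡⟨ cong (λ D → shfForm D P + shfIncrement m) (pred-pow2 m) ⟨
    shfClosed m + shfIncrement m ∎
    where
    P = pow2 m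
    identity : ∀ (sb σ P : ℤ) →
      sb + (+ 2 *ℤ P - + 1) *ℤ σ + + 2 *ℤ P - + 1
        ≡ sb + (P - + 1) *ℤ σ + P - + 1 + ((P *ℤ σ + P - + 1) + + 1)
    identity = solve-∀

  mul-count : ∀ m → scaledMul m ≡ mulClosed m
  mul-count = recurrence-unique (λ m x → x + mulIncrement m) scaledMul mulClosed
                mul-base scaledMul-step mulClosed-step

  add-count : ∀ m → scaledAdd m ≡ addClosed m
  add-count = recurrence-unique (λ m x → x + addIncrement m) scaledAdd addClosed
                add-base scaledAdd-step addClosed-step

  shf-count : ∀ m → scaledShf m ≡ shfClosed m
  shf-count = recurrence-unique (λ m x → x + shfIncrement m) scaledShf shfClosed
                shf-base scaledShf-step shfClosed-step

-- Proposition 2: the operation counts of the recursive scaled DCT-II of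
-- length N = q 2^m (the μ̃ and α̃ identities doubled).
proposition2 : (q m : ℕ) → q > 0 → q % 2 ≡ 1 → (b c : Cost) →
    let N = len q m
        r = scaledCost q b c m
    in ((+ 2) *ℤ (+ mul r)
          ≡ (+ 2) *ℤ (+ mul b) + (+ 2) *ℤ ((+ (2 ^ m ∸ 1)) *ℤ (+ mul c))
            + ((+ m) - (+ 2)) *ℤ (+ N) + (+ 2) *ℤ (+ q))
     × ((+ 2) *ℤ (+ add r)
          ≡ (+ 2) *ℤ (+ add b) + (+ 2) *ℤ ((+ (2 ^ m ∸ 1)) *ℤ (+ add c))
            + (+ 3) *ℤ ((+ m) *ℤ (+ N)) - (+ 2) *ℤ (+ (2 ^ m)) + (+ 2))
     × ((+ shf r)
          ≡ (+ shf b) + (+ (2 ^ m ∸ 1)) *ℤ (+ shf c) + (+ (2 ^ m)) - (+ 1))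
proposition2 q m q>0 _ b c = mul-count m , add-count m , shf-count m
  where open ScaledCounts q q>0 b c
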